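{- Let $\mathbb{F}$ be a finite field of order $q$ with $\mathrm{char}(\mathbb{F})\neq 2$, and let $g,h$ be two-dimensional subspaces of $\mathbb{F}^4$ which generate linear sudoku squares $M_g,M_h$ of parallel type. Then $M_g$ and $M_h$ are orthogonal if and only if $g\cap h=\{0\}$.
   Context: A sudoku square of order $n^2$ is a latin square of order $n^2$ such that, when the array is partitioned into $n\times n$ subsquares in the natural way, each subsquare contains every symbol. Locations of an array of order $q^2$ are identified with vectors $(x_1,x_2,x_3,x_4)\in\mathbb{F}^4$: $x_1$ is the large row (which horizontal band of $q$ subsquares), $x_2$ the mini row (row within the band), $x_3$ the large column, $x_4$ the mini column; so the row of a location is determined by $(x_1,x_2)$, its column by $(x_3,x_4)$, and its subsquare by $(x_1,x_3)$. For a two-dimensional subspace $g\subseteq\mathbb{F}^4$, the array $M_g$ assigns to the locations in each coset $x+g$ a common symbol, distinct cosets receiving distinct symbols. We say $g$ generates a linear sudoku square of parallel type if $M_g$ is a sudoku square. Two squares of the same order are orthogonal if, upon superimposition, each ordered pair of symbols occurs in exactly one location. -}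

module Defs where

open import Level using (Level; _⊔_)
open import Algebra.Bundles using (CommutativeRing)
open import Data.Nat using (ℕ)
open import Data.Fin using (Fin; zero; suc)
open import Data.Product using (Σ; ∃; _×_; _,_)
open import Relation.Nullary using (¬_)

IsField : ∀ {c ℓ} → CommutativeRing c ℓ → Set (c ⊔ ℓ)
IsField R = (¬ (1# ≈ 0#)) × (∀ x → ¬ (x ≈ 0#) → ∃ λ y → x * y ≈ 1#)
  where open CommutativeRing R

HasOrder : ∀ {c ℓ} → CommutativeRing c ℓ → ℕ → Set (c ⊔ ℓ)
HasOrder R q = Σ (Fin q → Carrier) λ e →
                 (∀ i j → e i ≈ e j → i ≡ j) × (∀ x → ∃ λ i → e i ≈ x)
  where
    open CommutativeRing R
    open import Relation.Binary.PropositionalEquality using (_≡_)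

CharNot2 : ∀ {c ℓ} → CommutativeRing c ℓ → Set ℓ
CharNot2 R = ¬ (1# + 1# ≈ 0#)
  where open CommutativeRing R

module Linear {c ℓ} (R : CommutativeRing c ℓ) where
  open CommutativeRing R hiding (zero)

  -- F^4 : locations (x₁ , x₂ , x₃ , x₄) = (x zero , x (suc zero) , ...)
  V : Set c
  V = Fin 4 → Carrier

  i1 i2 i3 i4 : Fin 4
  i1 = zero
  i2 = suc zero
  i3 = suc (suc zero)
  i4 = suc (suc (suc zero))

  _≈ᵥ_ : V → V → Set ℓ
  u ≈ᵥ v = ∀ i → u i ≈ v i

  0ᵥ : V
  0ᵥ _ = 0#

  _+ᵥ_ : V → V → V
  (u +ᵥ v) i = u i + v i

  _-ᵥ_ : V → V → V
  (u -ᵥ v) i = u i - v i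

  _·_ : Carrier → V → V
  (a · v) i = a * v i

  record Subspace2 : Set (c ⊔ ℓ) where
    field
      b₁ b₂ : V
      indep : ∀ a b → ((a · b₁) +ᵥ (b · b₂)) ≈ᵥ 0ᵥ → (a ≈ 0#) × (b ≈ 0#)

  open Subspace2 public

  _∈_ : V → Subspace2 → Set (c ⊔ ℓ)
  x ∈ g = ∃ λ a → ∃ λ b → x ≈ᵥ ((a · b₁ g) +ᵥ (b · b₂ g))

  -- In M_g the symbols are the cosets z + g; location x carries symbol z + g
  -- iff x ∈ z + g, i.e. x - z ∈ g.
  HasSymbol : Subspace2 → V → V → Set (c ⊔ ℓ)
  HasSymbol g x z = (x -ᵥ z) ∈ g

  ExactlyOnce : (V → Set ℓ) → Subspace2 → V → Set (c ⊔ ℓ)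
  ExactlyOnce P g z =
    (∃ λ x → P x × HasSymbol g x z) ×
    (∀ x y → P x → P y → HasSymbol g x z → HasSymbol g y z → x ≈ᵥ y)

  Row Col Box : Carrier → Carrier → V → Set ℓ
  Row a b x = (x i1 ≈ a) × (x i2 ≈ b)
  Col a b x = (x i3 ≈ a) × (x i4 ≈ b)
  Box a b x = (x i1 ≈ a) × (x i3 ≈ b)

  GeneratesSudoku : Subspace2 → Set (c ⊔ ℓ)
  GeneratesSudoku g = ∀ a b z →
    ExactlyOnce (Row a b) g z × ExactlyOnce (Col a b) g z × ExactlyOnce (Box a b) g z

  Orthogonal : Subspace2 → Subspace2 → Set (c ⊔ ℓ)
  Orthogonal g h = ∀ z w →
    (∃ λ x → HasSymbol g x z × HasSymbol h x w) ×
    (∀ x y → HasSymbol g x z → HasSymbol h x w →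
             HasSymbol g y z → HasSymbol h y w → x ≈ᵥ y)

  TrivialIntersection : Subspace2 → Subspace2 → Set (c ⊔ ℓ)
  TrivialIntersection g h = ∀ x → x ∈ g → x ∈ h → x ≈ᵥ 0ᵥ

-- The hypothesis that M_g is a sudoku square is only used through its rows:
-- every row contains the symbol 0 + g, so g meets every row, i.e. the
-- projection (x₁, x₂) restricted to g is onto F².  Choosing G₁, G₂ ∈ g and
-- H₁, H₂ ∈ h projecting to the standard basis, the map
-- (u, v) ↦ (x₃, x₄)-part of u (G₁ - H₁) + v (G₂ - H₂) is injective when
-- g ∩ h = 0, hence (being 2 × 2 over a field) onto, and this shows g + h = F⁴.
-- Then every pair of cosets z + g, w + h meets, and meets in exactly one
-- point since differences of common points lie in g ∩ h.  Conversely, a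
-- nonzero x ∈ g ∩ h shares the pair of symbols (0 + g, 0 + h) with 0.
module Submission where

open import Defs
open import Level using (_⊔_)
open import Algebra.Bundles using (CommutativeRing)
open import Data.Nat using (ℕ)
open import Function.Bundles using (_⇔_; mk⇔)
open import Data.Fin using (zero; suc)
open import Data.Product using (∃; _×_; _,_; proj₁; proj₂)
open import Relation.Nullary using (¬_)

module RingFacts {c ℓ} (F : CommutativeRing c ℓ) where
  open CommutativeRing F
  open import Algebra.Properties.Ring ring
    using (-‿involutive; -0#≈0#; -‿+-comm; x[y-z]≈xy-xz; //-rightDividesˡ; //-rightDividesʳ)
  open import Algebra.Properties.Ring ring public using (-‿distribˡ-*; -1*x≈-x; x∙y⁻¹≈ε⇒x≈y)
  open import Algebra.Properties.CommutativeSemigroup +-commutativeSemigroup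
    using (interchange; xy∙z≈xz∙y)
  open import Algebra.Solver.Ring.NaturalCoefficients.Default commutativeSemiring public
  open import Relation.Binary.Reasoning.Setoid setoid

  x-0≈x : ∀ x → x - 0# ≈ x
  x-0≈x x = trans (+-congˡ -0#≈0#) (+-identityʳ x)

  -x≈0⇒x≈0 : ∀ {x} → - x ≈ 0# → x ≈ 0#
  -x≈0⇒x≈0 {x} -x≈0 = trans (sym (-‿involutive x)) (trans (-‿cong -x≈0) -0#≈0#)

  x≈a⇒y≈a⇒x-y≈0 : ∀ {x y a} → x ≈ a → y ≈ a → x - y ≈ 0#
  x≈a⇒y≈a⇒x-y≈0 {a = a} x≈a y≈a = trans (+-cong x≈a (-‿cong y≈a)) (-‿inverseʳ a)

  [x+y]-x≈y : ∀ x y → (x + y) - x ≈ y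
  [x+y]-x≈y x y = trans (+-congʳ (+-comm x y)) (//-rightDividesʳ x y)

  x+[y-x]≈y : ∀ x y → x + (y - x) ≈ y
  x+[y-x]≈y x y = trans (+-comm x (y - x)) (//-rightDividesˡ x y)

  [x+y]-[u+v]≈[x-u]+[y-v] : ∀ x y u v → (x + y) - (u + v) ≈ (x - u) + (y - v)
  [x+y]-[u+v]≈[x-u]+[y-v] x y u v =
    trans (+-congˡ (sym (-‿+-comm u v))) (interchange x y (- u) (- v))

  [x-z]-[y-z]≈x-y : ∀ x y z → (x - z) - (y - z) ≈ x - y
  [x-z]-[y-z]≈x-y x y z = begin
    (x - z) - (y - z)    ≈⟨ [x+y]-[u+v]≈[x-u]+[y-v] x (- z) y (- z) ⟩
    (x - y) + (- z - - z) ≈⟨ +-congˡ (-‿inverseʳ (- z)) ⟩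
    (x - y) + 0#          ≈⟨ +-identityʳ (x - y) ⟩
    x - y                 ∎

  x-z≈u-y⇒[x+y]-z≈u : ∀ {x y z u} → x - z ≈ u - y → (x + y) - z ≈ u
  x-z≈u-y⇒[x+y]-z≈u {x} {y} {z} {u} eq = begin
    (x + y) - z ≈⟨ xy∙z≈xz∙y x y (- z) ⟩
    (x - z) + y ≈⟨ +-congʳ eq ⟩
    (u - y) + y ≈⟨ //-rightDividesˡ y u ⟩
    u           ∎

  [ap+bq]-[ap′+bq′]≈a[p-p′]+b[q-q′] : ∀ a b p q p′ q′ →
    (a * p + b * q) - (a * p′ + b * q′) ≈ a * (p - p′) + b * (q - q′)
  [ap+bq]-[ap′+bq′]≈a[p-p′]+b[q-q′] a b p q p′ q′ = begin
    (a * p + b * q) - (a * p′ + b * q′)     ≈⟨ [x+y]-[u+v]≈[x-u]+[y-v] _ _ _ _ ⟩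
    (a * p - a * p′) + (b * q - b * q′)     ≈⟨ +-cong (sym (x[y-z]≈xy-xz a p p′))
                                                      (sym (x[y-z]≈xy-xz b q q′)) ⟩
    a * (p - p′) + b * (q - q′)             ∎

  a*1+b*0≈a : ∀ {a b p q} → p ≈ 1# → q ≈ 0# → a * p + b * q ≈ a
  a*1+b*0≈a {a} {b} p≈1 q≈0 = begin
    a * _ + b * _   ≈⟨ +-cong (*-congˡ p≈1) (*-congˡ q≈0) ⟩
    a * 1# + b * 0# ≈⟨ +-cong (*-identityʳ a) (zeroʳ b) ⟩
    a + 0#          ≈⟨ +-identityʳ a ⟩
    a               ∎

  a*0+b*1≈b : ∀ {a b p q} → p ≈ 0# → q ≈ 1# → a * p + b * q ≈ b
  a*0+b*1≈b {a} {b} p≈0 q≈1 = trans (+-comm (a * _) (b * _)) (a*1+b*0≈a q≈1 p≈0)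

module TwoByTwo {c ℓ} (F : CommutativeRing c ℓ) (α β γ δ : CommutativeRing.Carrier F) where
  open CommutativeRing F
  open RingFacts F

  Solves : Carrier → Carrier → Carrier → Carrier → Set ℓ
  Solves u v r s = (u * α + v * β ≈ r) × (u * γ + v * δ ≈ s)

  Injective : Set (c ⊔ ℓ)
  Injective = ∀ u v → Solves u v 0# 0# → (u ≈ 0#) × (v ≈ 0#)

  det : Carrier
  det = α * δ - β * γ

  Solves-resp : ∀ {u v r s r′ s′} → r ≈ r′ → s ≈ s′ → Solves u v r s → Solves u v r′ s′
  Solves-resp r≈r′ s≈s′ (eq₁ , eq₂) = trans eq₁ r≈r′ , trans eq₂ s≈s′

  Solves-scale : ∀ a {u v r s} → Solves u v r s → Solves (a * u) (a * v) (a * r) (a * s)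
  Solves-scale a {u} {v} (eq₁ , eq₂) = row α β eq₁ , row γ δ eq₂
    where
    row : ∀ x y {t} → u * x + v * y ≈ t → (a * u) * x + (a * v) * y ≈ a * t
    row x y eq = trans
      (solve 5 (λ a u v x y → (a :* u) :* x :+ (a :* v) :* y := a :* (u :* x :+ v :* y)) refl a u v x y)
      (*-congˡ eq)

  Solves-+ : ∀ {u v r s u′ v′ r′ s′} → Solves u v r s → Solves u′ v′ r′ s′ →
             Solves (u + u′) (v + v′) (r + r′) (s + s′)
  Solves-+ {u} {v} {u′ = u′} {v′} (eq₁ , eq₂) (eq₁′ , eq₂′) = row α β eq₁ eq₁′ , row γ δ eq₂ eq₂′
    where
    row : ∀ x y {t t′} → u * x + v * y ≈ t → u′ * x + v′ * y ≈ t′ →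
          (u + u′) * x + (v + v′) * y ≈ t + t′
    row x y eq eq′ = trans
      (solve 6 (λ u v u′ v′ x y → (u :+ u′) :* x :+ (v :+ v′) :* y
                                 := (u :* x :+ v :* y) :+ (u′ :* x :+ v′ :* y)) refl u v u′ v′ x y)
      (+-cong eq eq′)

  -- The columns of the adjugate matrix.
  adjugate₁ : Solves δ (- γ) det 0#
  adjugate₁ = first , second
    where
    first : δ * α + - γ * β ≈ α * δ - β * γ
    first = +-cong (*-comm δ α) (trans (sym (-‿distribˡ-* γ β)) (-‿cong (*-comm γ β)))
    second : δ * γ + - γ * δ ≈ 0#
    second = trans (+-cong (*-comm δ γ) (sym (-‿distribˡ-* γ δ))) (-‿inverseʳ (γ * δ))

  adjugate₂ : Solves (- β) α 0# det
  adjugate₂ = first , second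
    where
    first : - β * α + α * β ≈ 0#
    first = trans (+-cong (sym (-‿distribˡ-* β α)) (*-comm α β)) (-‿inverseˡ (β * α))
    second : - β * γ + α * δ ≈ α * δ - β * γ
    second = trans (+-comm (- β * γ) (α * δ)) (+-congˡ (sym (-‿distribˡ-* β γ)))

  -- If det ≈ 0 both adjugate columns lie in the kernel, which forces the
  -- matrix to vanish, so that (1, 0) lies in the kernel too.
  det≉0 : ¬ (1# ≈ 0#) → Injective → ¬ (det ≈ 0#)
  det≉0 1≉0 injective det≈0 = 1≉0 (proj₁ (injective 1# 0# (row α≈0 β≈0 , row γ≈0 δ≈0)))
    where
    kernel₁ = injective δ (- γ) (Solves-resp det≈0 refl adjugate₁)
    kernel₂ = injective (- β) α (Solves-resp refl det≈0 adjugate₂)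
    α≈0 = proj₂ kernel₂
    β≈0 = -x≈0⇒x≈0 (proj₁ kernel₂)
    γ≈0 = -x≈0⇒x≈0 (proj₂ kernel₁)
    δ≈0 = proj₁ kernel₁
    row : ∀ {x y} → x ≈ 0# → y ≈ 0# → 1# * x + 0# * y ≈ 0#
    row {x} {y} x≈0 y≈0 = trans (+-cong (trans (*-identityˡ x) x≈0) (zeroˡ y)) (+-identityˡ 0#)

  injective⇒surjective : IsField F → Injective → ∀ r s → ∃ λ u → ∃ λ v → Solves u v r s
  injective⇒surjective (1≉0 , inverse) injective r s =
    _ , _ , Solves-resp (a*1+b*0≈a refl refl) (a*0+b*1≈b refl refl)
                        (Solves-+ (Solves-scale r onto₁) (Solves-scale s onto₂))
    where
    e : Carrier
    e = proj₁ (inverse det (det≉0 1≉0 injective))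
    e*det≈1 : e * det ≈ 1#
    e*det≈1 = trans (*-comm e det) (proj₂ (inverse det (det≉0 1≉0 injective)))
    onto₁ : Solves (e * δ) (e * - γ) 1# 0#
    onto₁ = Solves-resp e*det≈1 (zeroʳ e) (Solves-scale e adjugate₁)
    onto₂ : Solves (e * - β) (e * α) 0# 1#
    onto₂ = Solves-resp (zeroʳ e) e*det≈1 (Solves-scale e adjugate₂)

module Subspaces {c ℓ} (F : CommutativeRing c ℓ) where
  open CommutativeRing F hiding (zero)
  open RingFacts F
    using (x-0≈x; x≈a⇒y≈a⇒x-y≈0; [x+y]-x≈y; [x-z]-[y-z]≈x-y; x-z≈u-y⇒[x+y]-z≈u;
           [ap+bq]-[ap′+bq′]≈a[p-p′]+b[q-q′]; a*1+b*0≈a; a*0+b*1≈b; -1*x≈-x; x∙y⁻¹≈ε⇒x≈y;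
           solve; _:=_; _:+_; _:*_)
  open Linear F

  lin : Carrier → Carrier → V → V → V
  lin a b P Q = (a · P) +ᵥ (b · Q)

  ≈ᵥ-from-diff : ∀ {x y} → (x -ᵥ y) ≈ᵥ 0ᵥ → x ≈ᵥ y
  ≈ᵥ-from-diff {x} {y} x-y≈0 i = x∙y⁻¹≈ε⇒x≈y (x i) (y i) (x-y≈0 i)

  lin-Row : ∀ {P Q} a b → Row 1# 0# P → Row 0# 1# Q → Row a b (lin a b P Q)
  lin-Row a b (P₁≈1 , P₂≈0) (Q₁≈0 , Q₂≈1) = a*1+b*0≈a P₁≈1 Q₁≈0 , a*0+b*1≈b P₂≈0 Q₂≈1

  lin-sub : ∀ a b P Q P′ Q′ → (lin a b P Q -ᵥ lin a b P′ Q′) ≈ᵥ lin a b (P -ᵥ P′) (Q -ᵥ Q′)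
  lin-sub a b P Q P′ Q′ i = [ap+bq]-[ap′+bq′]≈a[p-p′]+b[q-q′] a b (P i) (Q i) (P′ i) (Q′ i)

  -ᵥ-Row : ∀ {a b x y} → Row a b x → Row a b y → Row 0# 0# (x -ᵥ y)
  -ᵥ-Row (x₁≈a , x₂≈b) (y₁≈a , y₂≈b) = x≈a⇒y≈a⇒x-y≈0 x₁≈a y₁≈a , x≈a⇒y≈a⇒x-y≈0 x₂≈b y₂≈b

  Row-resp : ∀ {a b x y} → x ≈ᵥ y → Row a b x → Row a b y
  Row-resp x≈y (x₁≈a , x₂≈b) = trans (sym (x≈y i1)) x₁≈a , trans (sym (x≈y i2)) x₂≈b

  module _ (g : Subspace2) where

    ∈-resp : ∀ {x y} → x ≈ᵥ y → x ∈ g → y ∈ g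
    ∈-resp x≈y (a , b , x≈) = a , b , λ i → trans (sym (x≈y i)) (x≈ i)

    lin-∈ : ∀ {P Q} a b → P ∈ g → Q ∈ g → lin a b P Q ∈ g
    lin-∈ a b (p , p′ , P≈) (q , q′ , Q≈) =
      a * p + b * q , a * p′ + b * q′ , λ i → trans (+-cong (*-congˡ (P≈ i)) (*-congˡ (Q≈ i)))
        (solve 8 (λ a b p p′ q q′ x y → a :* (p :* x :+ p′ :* y) :+ b :* (q :* x :+ q′ :* y)
                                       := (a :* p :+ b :* q) :* x :+ (a :* p′ :+ b :* q′) :* y)
               refl a b p p′ q q′ (b₁ g i) (b₂ g i))

    0ᵥ-∈ : 0ᵥ ∈ g
    0ᵥ-∈ = 0# , 0# , λ i → sym (trans (+-cong (zeroˡ (b₁ g i)) (zeroˡ (b₂ g i))) (+-identityˡ 0#))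

    -ᵥ-∈ : ∀ {x y} → x ∈ g → y ∈ g → (x -ᵥ y) ∈ g
    -ᵥ-∈ {x} {y} x∈g y∈g =
      ∈-resp (λ i → +-cong (*-identityˡ (x i)) (-1*x≈-x (y i))) (lin-∈ 1# (- 1#) x∈g y∈g)

    +ᵥ-∈ : ∀ {x y} → x ∈ g → y ∈ g → (x +ᵥ y) ∈ g
    +ᵥ-∈ {x} {y} x∈g y∈g =
      ∈-resp (λ i → +-cong (*-identityˡ (x i)) (*-identityˡ (y i))) (lin-∈ 1# 1# x∈g y∈g)

    HasSymbol-0ᵥ : ∀ {x} → x ∈ g → HasSymbol g x 0ᵥ
    HasSymbol-0ᵥ {x} = ∈-resp (λ i → sym (x-0≈x (x i)))

    HasSymbol-+ᵥ : ∀ {k} z → k ∈ g → HasSymbol g (z +ᵥ k) z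
    HasSymbol-+ᵥ {k} z = ∈-resp (λ i → sym ([x+y]-x≈y (z i) (k i)))

    HasSymbol-diff : ∀ {x y z} → HasSymbol g x z → HasSymbol g y z → (x -ᵥ y) ∈ g
    HasSymbol-diff {x} {y} {z} x∈z+g y∈z+g =
      ∈-resp (λ i → [x-z]-[y-z]≈x-y (x i) (y i) (z i)) (-ᵥ-∈ x∈z+g y∈z+g)

  MeetsEveryRow : Subspace2 → Set (c ⊔ ℓ)
  MeetsEveryRow g = ∀ a b → ∃ λ x → Row a b x × x ∈ g

  -- Row (a , b) of M_g contains the symbol 0 + g.
  sudoku⇒meetsEveryRow : ∀ g → GeneratesSudoku g → MeetsEveryRow g
  sudoku⇒meetsEveryRow g sudoku a b with proj₁ (proj₁ (sudoku a b 0ᵥ))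
  ... | x , row , x∈0+g = x , row , ∈-resp g (λ i → x-0≈x (x i)) x∈0+g

  -- g + h = F⁴, written with a difference since h = - h.
  JointlySpanning : Subspace2 → Subspace2 → Set (c ⊔ ℓ)
  JointlySpanning g h = ∀ t → ∃ λ k → ∃ λ m → k ∈ g × m ∈ h × t ≈ᵥ (k -ᵥ m)

  orthogonal⇒trivialIntersection : ∀ g h → Orthogonal g h → TrivialIntersection g h
  orthogonal⇒trivialIntersection g h orth x x∈g x∈h =
    proj₂ (orth 0ᵥ 0ᵥ) x 0ᵥ (HasSymbol-0ᵥ g x∈g) (HasSymbol-0ᵥ h x∈h)
                            (HasSymbol-0ᵥ g (0ᵥ-∈ g)) (HasSymbol-0ᵥ h (0ᵥ-∈ h))

  spanning⇒orthogonal : ∀ g h → JointlySpanning g h → TrivialIntersection g h → Orthogonal g h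
  spanning⇒orthogonal g h spanning trivial z w = meet , unique
    where
    meet : ∃ λ x → HasSymbol g x z × HasSymbol h x w
    meet with spanning (w -ᵥ z)
    ... | k , m , k∈g , m∈h , w-z≈k-m =
      w +ᵥ m , ∈-resp g (λ i → sym (x-z≈u-y⇒[x+y]-z≈u (w-z≈k-m i))) k∈g , HasSymbol-+ᵥ h w m∈h
    unique : ∀ x y → HasSymbol g x z → HasSymbol h x w → HasSymbol g y z → HasSymbol h y w → x ≈ᵥ y
    unique x y x∈z+g x∈w+h y∈z+g y∈w+h =
      ≈ᵥ-from-diff (trivial (x -ᵥ y) (HasSymbol-diff g x∈z+g y∈z+g) (HasSymbol-diff h x∈w+h y∈w+h))

module Spanning {c ℓ} (F : CommutativeRing c ℓ) (isField : IsField F) (g h : Linear.Subspace2 F)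
                (rows-g : Subspaces.MeetsEveryRow F g) (rows-h : Subspaces.MeetsEveryRow F h)
                (trivial : Linear.TrivialIntersection F g h) where
  open CommutativeRing F hiding (zero)
  open RingFacts F using (x+[y-x]≈y)
  open Linear F
  open Subspaces F

  G₁ G₂ H₁ H₂ : V
  G₁ = proj₁ (rows-g 1# 0#)
  G₂ = proj₁ (rows-g 0# 1#)
  H₁ = proj₁ (rows-h 1# 0#)
  H₂ = proj₁ (rows-h 0# 1#)

  inG : Carrier → Carrier → V
  inG u v = lin u v G₁ G₂

  inH : Carrier → Carrier → V
  inH u v = lin u v H₁ H₂

  inG-∈ : ∀ u v → inG u v ∈ g
  inG-∈ u v = lin-∈ g u v (proj₂ (proj₂ (rows-g 1# 0#))) (proj₂ (proj₂ (rows-g 0# 1#)))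

  inH-∈ : ∀ u v → inH u v ∈ h
  inH-∈ u v = lin-∈ h u v (proj₂ (proj₂ (rows-h 1# 0#))) (proj₂ (proj₂ (rows-h 0# 1#)))

  inG-Row : ∀ u v → Row u v (inG u v)
  inG-Row u v = lin-Row {G₁} {G₂} u v (proj₁ (proj₂ (rows-g 1# 0#))) (proj₁ (proj₂ (rows-g 0# 1#)))

  inH-Row : ∀ u v → Row u v (inH u v)
  inH-Row u v = lin-Row {H₁} {H₂} u v (proj₁ (proj₂ (rows-h 1# 0#))) (proj₁ (proj₂ (rows-h 0# 1#)))

  gap : Carrier → Carrier → V
  gap u v = lin u v (G₁ -ᵥ H₁) (G₂ -ᵥ H₂)

  inG-inH≈gap : ∀ u v → (inG u v -ᵥ inH u v) ≈ᵥ gap u v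
  inG-inH≈gap u v = lin-sub u v G₁ G₂ H₁ H₂

  gap-Row : ∀ u v → Row 0# 0# (gap u v)
  gap-Row u v = Row-resp (inG-inH≈gap u v) (-ᵥ-Row {x = inG u v} {inH u v} (inG-Row u v) (inH-Row u v))

  open TwoByTwo F ((G₁ -ᵥ H₁) i3) ((G₂ -ᵥ H₂) i3) ((G₁ -ᵥ H₁) i4) ((G₂ -ᵥ H₂) i4)

  -- A kernel vector (u, v) makes inG u v ≈ inH u v a vector of g ∩ h,
  -- whose first two coordinates are u and v.
  gap-injective : Injective
  gap-injective u v (gap₃≈0 , gap₄≈0) =
    trans (sym (proj₁ (inG-Row u v))) (inG≈0 i1) , trans (sym (proj₂ (inG-Row u v))) (inG≈0 i2)
    where
    gap≈0 : gap u v ≈ᵥ 0ᵥ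
    gap≈0 zero                      = proj₁ (gap-Row u v)
    gap≈0 (suc zero)                = proj₂ (gap-Row u v)
    gap≈0 (suc (suc zero))          = gap₃≈0
    gap≈0 (suc (suc (suc zero)))    = gap₄≈0
    inG≈inH : inG u v ≈ᵥ inH u v
    inG≈inH = ≈ᵥ-from-diff (λ i → trans (inG-inH≈gap u v i) (gap≈0 i))
    inG≈0 : inG u v ≈ᵥ 0ᵥ
    inG≈0 = trivial (inG u v) (inG-∈ u v) (∈-resp h (λ i → sym (inG≈inH i)) (inH-∈ u v))

  -- Write t = E + gap u v, where E ∈ g has the same row as t.
  jointlySpanning : JointlySpanning g h
  jointlySpanning t = decompose (injective⇒surjective isField gap-injective (t i3 - E i3) (t i4 - E i4))
    where
    E : V
    E = inG (t i1) (t i2)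
    decompose : (∃ λ u → ∃ λ v → Solves u v (t i3 - E i3) (t i4 - E i4)) →
                ∃ λ k → ∃ λ m → k ∈ g × m ∈ h × t ≈ᵥ (k -ᵥ m)
    decompose (u , v , gap₃≈ , gap₄≈) =
      E +ᵥ inG u v , inH u v , +ᵥ-∈ g (inG-∈ (t i1) (t i2)) (inG-∈ u v) , inH-∈ u v ,
      λ i → trans (t≈E+gap i) (trans (+-congˡ (sym (inG-inH≈gap u v i))) (sym (+-assoc _ _ _)))
      where
      t≈E+gap : t ≈ᵥ (E +ᵥ gap u v)
      t≈E+gap zero =
        sym (trans (+-cong (proj₁ (inG-Row (t i1) (t i2))) (proj₁ (gap-Row u v))) (+-identityʳ _))
      t≈E+gap (suc zero) =
        sym (trans (+-cong (proj₂ (inG-Row (t i1) (t i2))) (proj₂ (gap-Row u v))) (+-identityʳ _))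
      t≈E+gap (suc (suc zero))       = sym (trans (+-congˡ gap₃≈) (x+[y-x]≈y _ _))
      t≈E+gap (suc (suc (suc zero))) = sym (trans (+-congˡ gap₄≈) (x+[y-x]≈y _ _))

proposition2p3 : ∀ {c ℓ} (F : CommutativeRing c ℓ) → IsField F →
                 (q : ℕ) → HasOrder F q → CharNot2 F →
                 (g h : Linear.Subspace2 F) →
                 Linear.GeneratesSudoku F g → Linear.GeneratesSudoku F h →
                 (Linear.Orthogonal F g h ⇔ Linear.TrivialIntersection F g h)
proposition2p3 F isField _ _ _ g h sudoku-g sudoku-h =
  mk⇔ (orthogonal⇒trivialIntersection g h) trivialIntersection⇒orthogonal
  where
  open Linear F
  open Subspaces F
  trivialIntersection⇒orthogonal : TrivialIntersection g h → Orthogonal g h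
  trivialIntersection⇒orthogonal trivial = spanning⇒orthogonal g h spanning trivial
    where
    spanning : JointlySpanning g h
    spanning = Spanning.jointlySpanning F isField g h
                 (sudoku⇒meetsEveryRow g sudoku-g) (sudoku⇒meetsEveryRow h sudoku-h) trivial
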